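{- Let $\mathrm{inc}^{\mathrm{run}}(n,k)$ be the number of increasing permutations of length $n$ with exactly $k$ runs. Then $\mathrm{inc}^{\mathrm{run}}(0,0)=1$, $\mathrm{inc}^{\mathrm{run}}(n,0)=0$ for $n\ge1$, and for all $n,k\ge1$, $$\mathrm{inc}^{\mathrm{run}}(n+1,k)=\mathrm{inc}^{\mathrm{run}}(n,k)+\mathrm{inc}^{\mathrm{run}}(n,k-1)+\sum_{i=1}^{n-1}\sum_{j=1}^{k-1}\binom{n}{i}\binom{i-1}{k-j-1}\mathrm{inc}^{\mathrm{run}}(n-i,j).$$
   Context: A permutation of $[n]$ is written $\pi=\pi_1\cdots\pi_n$; the empty permutation is included for $n=0$. A valley of $\pi$ is an index $\ell$ with $2\le\ell\le n-1$ and $\pi_{\ell-1}>\pi_\ell<\pi_{\ell+1}$; its height is $\pi_\ell$. A permutation is increasing if the heights of its valleys, read from left to right, form an increasing sequence. A run is a maximal block of consecutive increasing entries; the number of runs of a nonempty permutation is $1$ plus its number of descents, and the empty permutation has $0$ runs. -}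

module Defs where

open import Data.Nat using (ℕ; zero; suc; _+_; _*_; _∸_; _<_; _<ᵇ_; _≡ᵇ_)
open import Data.Bool using (Bool; true; false; _∧_; _∨_; not; if_then_else_)
open import Data.List using (List; []; _∷_; map; concatMap; length; filter; upTo)
open import Data.Nat.ListAction using (sum)

words : ℕ → ℕ → List (List ℕ)
words n zero    = [] ∷ []
words n (suc m) = concatMap (λ w → map (λ a → a ∷ w) (map suc (upTo n))) (words n m)

elemᵇ : ℕ → List ℕ → Bool
elemᵇ a []       = false
elemᵇ a (x ∷ xs) = (a ≡ᵇ x) ∨ elemᵇ a xs

distinctᵇ : List ℕ → Bool
distinctᵇ []       = true
distinctᵇ (x ∷ xs) = not (elemᵇ x xs) ∧ distinctᵇ xs

-- Permutations of [n] = words of length n over [n] with distinct entries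
-- (written in one-line notation π₁ ⋯ πₙ).
perms : ℕ → List (List ℕ)
perms n = filter (λ w → Relation.Nullary.Decidable.Core.T? (distinctᵇ w)) (words n n)
  where import Relation.Nullary.Decidable.Core

valleyHeights : List ℕ → List ℕ
valleyHeights (a ∷ b ∷ c ∷ xs) =
  if (b <ᵇ a) ∧ (b <ᵇ c) then b ∷ valleyHeights (b ∷ c ∷ xs)
                          else valleyHeights (b ∷ c ∷ xs)
valleyHeights _ = []

strictlyIncᵇ : List ℕ → Bool
strictlyIncᵇ (a ∷ b ∷ xs) = (a <ᵇ b) ∧ strictlyIncᵇ (b ∷ xs)
strictlyIncᵇ _ = true

isIncreasingᵇ : List ℕ → Bool
isIncreasingᵇ π = strictlyIncᵇ (valleyHeights π)

descents : List ℕ → ℕ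
descents (a ∷ b ∷ xs) = (if b <ᵇ a then 1 else 0) + descents (b ∷ xs)
descents _ = 0

runs : List ℕ → ℕ
runs []         = 0
runs π@(_ ∷ _)  = suc (descents π)

incRun : ℕ → ℕ → ℕ
incRun n k = length (filter (λ π → T? (isIncreasingᵇ π ∧ (runs π ≡ᵇ k))) (perms n))
  where open import Relation.Nullary.Decidable.Core using (T?)

-- Σ_{i=a}^{b} f i  (empty when b < a).
sumFromTo : ℕ → ℕ → (ℕ → ℕ) → ℕ
sumFromTo a b f = sum (map (λ t → f (a + t)) (upTo (suc b ∸ a)))

-- Write a permutation of a set as α x β with x its least entry. Since x lies below its
-- neighbours, the valleys of α x β are those of α, then x (if α and β are both nonempty),
-- then those of β, and des(α x β) = des α + 1 + des β (when α is nonempty). Hence α x β is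
-- increasing with k runs iff β = [] and α is increasing with k − 1 runs, or α = [] and β is
-- increasing with k runs, or α has no valleys and β is increasing with k − 1 − des α runs.
-- A valley-free permutation of an i-set rises to its maximum and then falls, so it is fixed
-- by which d of the other i − 1 entries follow the maximum, where d is its number of
-- descents: there are C(i − 1, d) of them. Both statistics only see relative order, so
-- summing over the C(n, i) choices of the entry set of α gives the recurrence.

module Submission where

open import Defs
open import Data.Nat using (ℕ; zero; suc; _+_; _*_; _∸_; _≥_; _≤_; _<_; _<ᵇ_; _≡ᵇ_; z≤n; s≤s)
open import Data.Nat.Properties
open import Data.Nat.ListAction using (sum)
open import Data.Nat.Combinatorics using (_C_; k>n⇒nCk≡0; nCn≡1; nCk+nC[k+1]≡[n+1]C[k+1])
open import Data.Bool using (Bool; true; false; _∧_; if_then_else_; T)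
open import Data.Bool.Properties using (∧-assoc; ∧-zeroʳ)
open import Data.Unit using (tt)
open import Data.Empty using (⊥; ⊥-elim)
open import Data.Product using (_×_; _,_; proj₁; proj₂; ∃-syntax; map₁; map₂)
open import Data.Sum using (_⊎_; inj₁; inj₂)
open import Function.Bundles using (mk⇔)
open import Relation.Nullary using (yes; no)
open import Relation.Nullary.Decidable.Core using (T?)
open import Relation.Binary.PropositionalEquality
open import Data.List using (List; []; _∷_; map; concatMap; length; filter; upTo; _++_; applyUpTo)
open import Data.List.Properties using (++-assoc; length-++; ∷-injective; ++-identityʳ; ++-cancelˡ)
open import Data.List.Membership.Propositional using (_∈_; _∉_; find; lose)
open import Data.List.Membership.DecPropositional _≟_ using (_∈?_)
open import Data.List.Membership.Propositional.Properties using (∈-++⁻; ∈-++⁺ˡ; ∈-++⁺ʳ; ∈-map⁺; ∈-map⁻; ∈-∃++; ∈-filter⁺; ∈-filter⁻; ∈-concatMap⁺; ∈-concatMap⁻)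
open import Data.List.Membership.Propositional.Properties.WithK using (unique∧set⇒bag)
open import Data.List.Relation.Binary.BagAndSetEquality using (∼bag⇒↭)
open import Data.List.Relation.Unary.Any using (here; there)
open import Data.List.Relation.Unary.All as All using (All; []; _∷_)
open import Data.List.Relation.Unary.AllPairs as AllPairs using (AllPairs; []; _∷_)
open import Data.List.Relation.Unary.Unique.Propositional using (Unique)
import Data.List.Relation.Unary.Unique.Propositional.Properties as Unique
import Data.List.Relation.Unary.All.Properties as All
open import Data.List.Relation.Binary.Subset.Propositional using (_⊆_)
open import Data.List.Relation.Binary.Pointwise as Pointwise using (Pointwise; []; _∷_)
open import Data.List.Relation.Binary.Permutation.Propositional using (_↭_; prep; swap; ↭-sym; ↭⇒↭ₛ) renaming (refl to ↭-refl; trans to ↭-trans)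
open import Data.List.Relation.Binary.Permutation.Propositional.Properties using (shift; drop-mid; ↭-empty-inv; ∈-resp-↭; ↭-length; ++⁺; All-resp-↭)
import Data.List.Relation.Binary.Permutation.Setoid.Properties as Permutationₛ
open import Algebra.Properties.CommutativeSemigroup +-commutativeSemigroup using (x∙yz≈y∙xz; interchange)
open import Function using (_∘_; case_of_)

𝟙 : Bool → ℕ
𝟙 true  = 1
𝟙 false = 0

sumBy : {A : Set} → (A → ℕ) → List A → ℕ
sumBy f []       = 0
sumBy f (x ∷ xs) = f x + sumBy f xs

count : {A : Set} → (A → Bool) → List A → ℕ
count q = sumBy (λ x → 𝟙 (q x))

module _ {A : Set} where

  sumBy-cong : ∀ {f g : A → ℕ} xs → (∀ {x} → x ∈ xs → f x ≡ g x) → sumBy f xs ≡ sumBy g xs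
  sumBy-cong []       h = refl
  sumBy-cong (x ∷ xs) h = cong₂ _+_ (h (here refl)) (sumBy-cong xs (h ∘ there))

  sumBy-++ : ∀ (f : A → ℕ) xs ys → sumBy f (xs ++ ys) ≡ sumBy f xs + sumBy f ys
  sumBy-++ f []       ys = refl
  sumBy-++ f (x ∷ xs) ys = trans (cong (f x +_) (sumBy-++ f xs ys)) (sym (+-assoc (f x) _ _))

  sumBy-concatMap : ∀ {B : Set} (f : A → ℕ) (g : B → List A) xs →
    sumBy f (concatMap g xs) ≡ sumBy (λ x → sumBy f (g x)) xs
  sumBy-concatMap f g []       = refl
  sumBy-concatMap f g (x ∷ xs) = trans (sumBy-++ f (g x) _) (cong (sumBy f (g x) +_) (sumBy-concatMap f g xs))

  sumBy-map : ∀ {B : Set} (f : A → ℕ) (g : B → A) xs → sumBy f (map g xs) ≡ sumBy (λ x → f (g x)) xs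
  sumBy-map f g []       = refl
  sumBy-map f g (x ∷ xs) = cong (f (g x) +_) (sumBy-map f g xs)

  sumBy-zero : ∀ (f : A → ℕ) xs → (∀ {x} → x ∈ xs → f x ≡ 0) → sumBy f xs ≡ 0
  sumBy-zero f xs h = trans (sumBy-cong xs h) (sumBy-const0 xs)
    where
    sumBy-const0 : ∀ xs → sumBy (λ _ → 0) xs ≡ 0
    sumBy-const0 []       = refl
    sumBy-const0 (_ ∷ xs) = sumBy-const0 xs

  sumBy-↭ : ∀ (f : A → ℕ) {xs ys} → xs ↭ ys → sumBy f xs ≡ sumBy f ys
  sumBy-↭ f ↭-refl        = refl
  sumBy-↭ f (prep x p)    = cong (f x +_) (sumBy-↭ f p)
  sumBy-↭ f (swap x y p)  = trans (x∙yz≈y∙xz (f x) (f y) _) (cong (λ s → f y + (f x + s)) (sumBy-↭ f p))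
  sumBy-↭ f (↭-trans p q) = trans (sumBy-↭ f p) (sumBy-↭ f q)

  length-filter≡count : ∀ q (xs : List A) → length (filter (λ x → T? (q x)) xs) ≡ count q xs
  length-filter≡count q []       = refl
  length-filter≡count q (x ∷ xs) with q x
  ... | true  = cong suc (length-filter≡count q xs)
  ... | false = length-filter≡count q xs

  count-cong : ∀ {q r : A → Bool} xs → (∀ {x} → x ∈ xs → q x ≡ r x) → count q xs ≡ count r xs
  count-cong xs h = sumBy-cong xs (cong 𝟙 ∘ h)

  count-none : ∀ (q : A → Bool) xs → (∀ {x} → x ∈ xs → q x ≡ false) → count q xs ≡ 0
  count-none q xs h = sumBy-zero _ xs (cong 𝟙 ∘ h)

  count-∧ : ∀ c q (xs : List A) → count (λ x → c ∧ q x) xs ≡ 𝟙 c * count q xs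
  count-∧ true  q xs = sym (+-identityʳ (count q xs))
  count-∧ false q xs = sumBy-zero _ xs (λ _ → refl)

sumBelow : ℕ → (ℕ → ℕ) → ℕ
sumBelow zero    f = 0
sumBelow (suc n) f = f 0 + sumBelow n (f ∘ suc)

sumFromTo1≡sumBelow : ∀ b f → sumFromTo 1 b f ≡ sumBelow b (f ∘ suc)
sumFromTo1≡sumBelow b f = go b (λ i → i)
  where
  go : ∀ n (h : ℕ → ℕ) → sum (map (λ t → f (1 + t)) (applyUpTo h n)) ≡ sumBelow n (λ i → f (suc (h i)))
  go zero    h = refl
  go (suc n) h = cong (f (suc (h 0)) +_) (go n (h ∘ suc))

sumBelow-cong : ∀ n {f g} → (∀ i → i < n → f i ≡ g i) → sumBelow n f ≡ sumBelow n g
sumBelow-cong zero    h = refl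
sumBelow-cong (suc n) h = cong₂ _+_ (h 0 (s≤s z≤n)) (sumBelow-cong n (λ i i<n → h (suc i) (s≤s i<n)))

sumBelow-zero : ∀ n f → (∀ i → i < n → f i ≡ 0) → sumBelow n f ≡ 0
sumBelow-zero zero    f h = refl
sumBelow-zero (suc n) f h = cong₂ _+_ (h 0 (s≤s z≤n)) (sumBelow-zero n (f ∘ suc) (λ i i<n → h (suc i) (s≤s i<n)))

sumBelow-suc : ∀ n f → sumBelow (suc n) f ≡ sumBelow n f + f n
sumBelow-suc zero    f = +-comm (f 0) 0
sumBelow-suc (suc n) f = trans (cong (f 0 +_) (sumBelow-suc n (f ∘ suc))) (sym (+-assoc (f 0) _ _))

sumBelow-+ : ∀ n f g → sumBelow n (λ i → f i + g i) ≡ sumBelow n f + sumBelow n g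
sumBelow-+ zero    f g = refl
sumBelow-+ (suc n) f g =
  trans (cong (f 0 + g 0 +_) (sumBelow-+ n (f ∘ suc) (g ∘ suc))) (interchange (f 0) (g 0) _ _)

*-distribˡ-sumBelow : ∀ n c f → c * sumBelow n f ≡ sumBelow n (λ i → c * f i)
*-distribˡ-sumBelow zero    c f = *-zeroʳ c
*-distribˡ-sumBelow (suc n) c f =
  trans (*-distribˡ-+ c (f 0) _) (cong (c * f 0 +_) (*-distribˡ-sumBelow n c (f ∘ suc)))

sumBelow-extend : ∀ m n f → m ≤ n → (∀ i → m ≤ i → i < n → f i ≡ 0) → sumBelow n f ≡ sumBelow m f
sumBelow-extend zero    n       f z≤n       h = sumBelow-zero n f (λ i i<n → h i z≤n i<n)
sumBelow-extend (suc m) (suc n) f (s≤s m≤n) h =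
  cong (f 0 +_) (sumBelow-extend m n (f ∘ suc) m≤n (λ i m≤i i<n → h (suc i) (s≤s m≤i) (s≤s i<n)))

sumBelow-reverse : ∀ n f → sumBelow n f ≡ sumBelow n (λ i → f (n ∸ suc i))
sumBelow-reverse zero    f = refl
sumBelow-reverse (suc n) f = begin
    f 0 + sumBelow n (f ∘ suc)
  ≡⟨ cong (f 0 +_) (sumBelow-reverse n (f ∘ suc)) ⟩
    f 0 + sumBelow n (λ i → f (suc (n ∸ suc i)))
  ≡⟨ +-comm (f 0) _ ⟩
    sumBelow n (λ i → f (suc (n ∸ suc i))) + f 0
  ≡⟨ cong₂ _+_ (sumBelow-cong n (λ i i<n → cong f (sym (+-∸-assoc 1 i<n)))) (cong f (sym (n∸n≡0 n))) ⟩
    sumBelow n (λ i → f (suc n ∸ suc i)) + f (suc n ∸ suc n)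
  ≡⟨ sym (sumBelow-suc n (λ i → f (suc n ∸ suc i))) ⟩
    sumBelow (suc n) (λ i → f (suc n ∸ suc i)) ∎
  where open ≡-Reasoning

sumBelow-indicator : ∀ n e (g : ℕ → ℕ) → e < n → sumBelow n (λ d → 𝟙 (e ≡ᵇ d) * g d) ≡ g e
sumBelow-indicator (suc n) zero    g _ =
  trans (cong₂ _+_ (+-identityʳ (g 0)) (sumBelow-zero n _ (λ _ _ → refl))) (+-identityʳ (g 0))
sumBelow-indicator (suc n) (suc e) g (s≤s e<n) = sumBelow-indicator n e (g ∘ suc) e<n

-- Permutations of x ∷ R as α ++ x ∷ β

Split : Set
Split = List ℕ × List ℕ

splits : List ℕ → List Split
splits []      = ([] , []) ∷ []
splits (x ∷ R) = map (map₁ (x ∷_)) (splits R) ++ map (map₂ (x ∷_)) (splits R)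

-- The fuel f only has to bound the length of S.
arrangements : ℕ → List ℕ → List (List ℕ)
arrangements _       []      = [] ∷ []
arrangements zero    (_ ∷ _) = []
arrangements (suc f) (x ∷ R) = concatMap (λ p →
  concatMap (λ α → map (λ β → α ++ x ∷ β) (arrangements f (proj₂ p))) (arrangements f (proj₁ p))) (splits R)

∈-concatMap⁻′ : ∀ {A B : Set} (g : A → List B) xs {y} → y ∈ concatMap g xs → ∃[ x ] x ∈ xs × y ∈ g x
∈-concatMap⁻′ g xs m = find (∈-concatMap⁻ g m)

∈-concatMap⁺′ : ∀ {A B : Set} (g : A → List B) {xs x y} → x ∈ xs → y ∈ g x → y ∈ concatMap g xs
∈-concatMap⁺′ g mx my = ∈-concatMap⁺ g (lose mx my)

Unique-concatMap : ∀ {A B : Set} (g : A → List B) xs → Unique xs → (∀ {x} → x ∈ xs → Unique (g x)) →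
  (∀ {x x' y} → x ∈ xs → x' ∈ xs → y ∈ g x → y ∈ g x' → x ≡ x') → Unique (concatMap g xs)
Unique-concatMap g []       _        _  _  = []
Unique-concatMap g (x ∷ xs) (x∉ ∷ u) ug dj =
  Unique.++⁺ (ug (here refl)) (Unique-concatMap g xs u (ug ∘ there) (λ m m' → dj (there m) (there m')))
    (λ (y₁ , y₂) → disjoint y₁ y₂)
  where
  disjoint : ∀ {y} → y ∈ g x → y ∈ concatMap g xs → ⊥
  disjoint y₁ y₂ with ∈-concatMap⁻′ g xs y₂
  ... | x' , mx' , y₃ with dj (here refl) (there mx') y₁ y₃
  ... | refl = Unique.Unique[x∷xs]⇒x∉xs (x∉ ∷ u) mx'

module _ {x : ℕ} {R : List ℕ} where

  ∈-splits⁻ : ∀ {p} → p ∈ splits (x ∷ R) →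
    (∃[ p₀ ] p₀ ∈ splits R × p ≡ map₁ (x ∷_) p₀) ⊎ (∃[ p₀ ] p₀ ∈ splits R × p ≡ map₂ (x ∷_) p₀)
  ∈-splits⁻ m with ∈-++⁻ (map (map₁ (x ∷_)) (splits R)) m
  ... | inj₁ m₁ = inj₁ (∈-map⁻ (map₁ (x ∷_)) m₁)
  ... | inj₂ m₂ = inj₂ (∈-map⁻ (map₂ (x ∷_)) m₂)

  ∈-splits⁺ˡ : ∀ {p} → p ∈ splits R → map₁ (x ∷_) p ∈ splits (x ∷ R)
  ∈-splits⁺ˡ m = ∈-++⁺ˡ (∈-map⁺ (map₁ (x ∷_)) m)

  ∈-splits⁺ʳ : ∀ {p} → p ∈ splits R → map₂ (x ∷_) p ∈ splits (x ∷ R)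
  ∈-splits⁺ʳ m = ∈-++⁺ʳ (map (map₁ (x ∷_)) (splits R)) (∈-map⁺ (map₂ (x ∷_)) m)

splits-↭ : ∀ R {p} → p ∈ splits R → proj₁ p ++ proj₂ p ↭ R
splits-↭ []      (here refl) = ↭-refl
splits-↭ (x ∷ R) m with ∈-splits⁻ {x} {R} m
... | inj₁ (p₀ , m₀ , refl) = prep x (splits-↭ R m₀)
... | inj₂ (p₀ , m₀ , refl) = ↭-trans (shift x (proj₁ p₀) (proj₂ p₀)) (prep x (splits-↭ R m₀))

splits-length : ∀ R {p} → p ∈ splits R → length (proj₁ p) + length (proj₂ p) ≡ length R
splits-length R {p} m = trans (sym (length-++ (proj₁ p))) (↭-length (splits-↭ R m))

splits-length-≤ : ∀ R {p f} → p ∈ splits R → length R ≤ f → length (proj₁ p) ≤ f × length (proj₂ p) ≤ f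
splits-length-≤ R m le =
    ≤-trans (≤-trans (m≤m+n _ _) (≤-reflexive (splits-length R m))) le
  , ≤-trans (≤-trans (m≤n+m _ _) (≤-reflexive (splits-length R m))) le

splits-⊆ : ∀ R {p} → p ∈ splits R → proj₁ p ⊆ R × proj₂ p ⊆ R
splits-⊆ R m = (λ z → ∈-resp-↭ (splits-↭ R m) (∈-++⁺ˡ z)) , (λ z → ∈-resp-↭ (splits-↭ R m) (∈-++⁺ʳ _ z))

splits-complete : ∀ α β R → α ++ β ↭ R → ∃[ p ] p ∈ splits R × α ↭ proj₁ p × β ↭ proj₂ p
splits-complete [] [] [] q = ([] , []) , here refl , ↭-refl , ↭-refl
splits-complete [] (b ∷ β) [] q with ↭-empty-inv q
... | ()
splits-complete (a ∷ α) β [] q with ↭-empty-inv q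
... | ()
splits-complete α β (y ∷ R) q with ∈-++⁻ α (∈-resp-↭ (↭-sym q) (here refl))
... | inj₁ yα with ∈-∃++ yα
... | α₁ , α₂ , refl with splits-complete (α₁ ++ α₂) β R
        (subst (_↭ R) (sym (++-assoc α₁ α₂ β))
          (drop-mid α₁ [] {α₂ ++ β} {R} (subst (_↭ y ∷ R) (++-assoc α₁ (y ∷ α₂) β) q)))
... | p₀ , m₀ , q₁ , q₂ = map₁ (y ∷_) p₀ , ∈-splits⁺ˡ {y} {R} m₀ , ↭-trans (shift y α₁ α₂) (prep y q₁) , q₂
splits-complete α β (y ∷ R) q | inj₂ yβ with ∈-∃++ yβ
... | β₁ , β₂ , refl with splits-complete α (β₁ ++ β₂) R
        (subst (_↭ R) (++-assoc α β₁ β₂)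
          (drop-mid (α ++ β₁) [] {β₂} {R} (subst (_↭ y ∷ R) (sym (++-assoc α β₁ (y ∷ β₂))) q)))
... | p₀ , m₀ , q₁ , q₂ = map₂ (y ∷_) p₀ , ∈-splits⁺ʳ {y} {R} m₀ , q₁ , ↭-trans (shift y β₁ β₂) (prep y q₂)

Unique-resp-↭ : ∀ {xs ys : List ℕ} → xs ↭ ys → Unique xs → Unique ys
Unique-resp-↭ p = Permutationₛ.Unique-resp-↭ (setoid ℕ) (↭⇒↭ₛ p)

Unique-++⁻ : ∀ (xs : List ℕ) {ys} → Unique (xs ++ ys) → Unique xs × Unique ys
Unique-++⁻ []       u        = [] , u
Unique-++⁻ (x ∷ xs) (x∉ ∷ u) = (All.++⁻ˡ xs x∉ ∷ proj₁ (Unique-++⁻ xs u)) , proj₂ (Unique-++⁻ xs u)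

splits-Unique : ∀ R → Unique R → Unique (splits R)
splits-Unique []      _        = [] ∷ []
splits-Unique (y ∷ R) (y∉ ∷ u) =
  Unique.++⁺ (Unique.map⁺ injˡ (splits-Unique R u)) (Unique.map⁺ injʳ (splits-Unique R u))
    (λ (m₁ , m₂) → disjoint m₁ m₂)
  where
  injˡ : ∀ {p p' : Split} → map₁ (y ∷_) p ≡ map₁ (y ∷_) p' → p ≡ p'
  injˡ refl = refl
  injʳ : ∀ {p p' : Split} → map₂ (y ∷_) p ≡ map₂ (y ∷_) p' → p ≡ p'
  injʳ refl = refl
  disjoint : ∀ {v} → v ∈ map (map₁ (y ∷_)) (splits R) → v ∈ map (map₂ (y ∷_)) (splits R) → ⊥
  disjoint m₁ m₂ with ∈-map⁻ (map₁ (y ∷_)) m₁ | ∈-map⁻ (map₂ (y ∷_)) m₂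
  ... | p , mp , refl | p' , mp' , e =
    Unique.Unique[x∷xs]⇒x∉xs (y∉ ∷ u) (proj₁ (splits-⊆ R mp') (subst (y ∈_) (cong proj₁ e) (here refl)))

splits-injective : ∀ R {p p'} → Unique R → p ∈ splits R → p' ∈ splits R →
  proj₁ p ⊆ proj₁ p' → proj₁ p' ⊆ proj₁ p → p ≡ p'
splits-injective []      _        (here refl) (here refl) _ _ = refl
splits-injective (y ∷ R) (y∉ ∷ u) m m' s s' with ∈-splits⁻ {y} {R} m | ∈-splits⁻ {y} {R} m'
... | inj₁ (p₀ , m₀ , refl) | inj₁ (p₀' , m₀' , refl) =
  cong (map₁ (y ∷_)) (splits-injective R u m₀ m₀' (drop-y s (proj₁ (splits-⊆ R m₀))) (drop-y s' (proj₁ (splits-⊆ R m₀'))))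
  where
  drop-y : ∀ {A A'} → y ∷ A ⊆ y ∷ A' → A ⊆ R → A ⊆ A'
  drop-y ss sub {z} mz with ss (there mz)
  ... | here refl = ⊥-elim (Unique.Unique[x∷xs]⇒x∉xs (y∉ ∷ u) (sub mz))
  ... | there w   = w
... | inj₁ (p₀ , m₀ , refl) | inj₂ (p₀' , m₀' , refl) =
  ⊥-elim (Unique.Unique[x∷xs]⇒x∉xs (y∉ ∷ u) (proj₁ (splits-⊆ R m₀') (s (here refl))))
... | inj₂ (p₀ , m₀ , refl) | inj₁ (p₀' , m₀' , refl) =
  ⊥-elim (Unique.Unique[x∷xs]⇒x∉xs (y∉ ∷ u) (proj₁ (splits-⊆ R m₀) (s' (here refl))))
... | inj₂ (p₀ , m₀ , refl) | inj₂ (p₀' , m₀' , refl) = cong (map₂ (y ∷_)) (splits-injective R u m₀ m₀' s s')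

module _ {f : ℕ} {x : ℕ} {R : List ℕ} where

  ∈-arrangements⁻ : ∀ {π} → π ∈ arrangements (suc f) (x ∷ R) →
    ∃[ p ] p ∈ splits R × ∃[ α ] α ∈ arrangements f (proj₁ p) × ∃[ β ] β ∈ arrangements f (proj₂ p) × π ≡ α ++ x ∷ β
  ∈-arrangements⁻ m with ∈-concatMap⁻′ _ (splits R) m
  ... | p , mp , m₂ with ∈-concatMap⁻′ _ (arrangements f (proj₁ p)) m₂
  ... | α , mα , m₃ with ∈-map⁻ (λ β → α ++ x ∷ β) m₃
  ... | β , mβ , eq = p , mp , α , mα , β , mβ , eq

  ∈-arrangements⁺ : ∀ {p α β} → p ∈ splits R → α ∈ arrangements f (proj₁ p) → β ∈ arrangements f (proj₂ p) →
    α ++ x ∷ β ∈ arrangements (suc f) (x ∷ R)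
  ∈-arrangements⁺ {p} {α} mp mα mβ =
    ∈-concatMap⁺′ _ mp (∈-concatMap⁺′ _ mα (∈-map⁺ (λ β → α ++ x ∷ β) mβ))

arrangements-↭ : ∀ f S {π} → π ∈ arrangements f S → π ↭ S
arrangements-↭ f       []      (here refl) = ↭-refl
arrangements-↭ (suc f) (x ∷ R) m with ∈-arrangements⁻ {f} {x} {R} m
... | p , mp , α , mα , β , mβ , refl = ↭-trans (shift x α β)
  (prep x (↭-trans (++⁺ (arrangements-↭ f (proj₁ p) mα) (arrangements-↭ f (proj₂ p) mβ)) (splits-↭ R mp)))

arrangements-complete : ∀ f S {π} → length S ≤ f → π ↭ S → π ∈ arrangements f S
arrangements-complete f       []      _         q rewrite ↭-empty-inv q = here refl
arrangements-complete (suc f) (x ∷ R) (s≤s le) q with ∈-∃++ (∈-resp-↭ (↭-sym q) (here refl))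
... | α , β , refl with splits-complete α β R (drop-mid α [] {β} {R} q)
... | p , mp , q₁ , q₂ = ∈-arrangements⁺ {f} {x} {R} mp
        (arrangements-complete f (proj₁ p) (proj₁ (splits-length-≤ R mp le)) q₁)
        (arrangements-complete f (proj₂ p) (proj₂ (splits-length-≤ R mp le)) q₂)

++-∷-injective : ∀ {x : ℕ} α α' {β β'} → x ∉ α → x ∉ α' → α ++ x ∷ β ≡ α' ++ x ∷ β' → α ≡ α' × β ≡ β'
++-∷-injective []      []        _ _  e = refl , proj₂ (∷-injective e)
++-∷-injective []      (a' ∷ α') _ n' e = ⊥-elim (n' (here (proj₁ (∷-injective e))))
++-∷-injective (a ∷ α) []        n _  e = ⊥-elim (n (here (sym (proj₁ (∷-injective e)))))
++-∷-injective (a ∷ α) (a' ∷ α') n n' e with ∷-injective e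
... | refl , e' with ++-∷-injective α α' (n ∘ there) (n' ∘ there) e'
... | refl , refl = refl , refl

arrangements-Unique : ∀ f S → Unique S → Unique (arrangements f S)
arrangements-Unique f       []      _        = [] ∷ []
arrangements-Unique zero    (x ∷ R) _        = []
arrangements-Unique (suc f) (x ∷ R) (x∉ ∷ u) =
  Unique-concatMap _ (splits R) (splits-Unique R u) (λ mp → aroundUnique mp) samePart
  where
  parts-Unique : ∀ {p} → p ∈ splits R → Unique (proj₁ p) × Unique (proj₂ p)
  parts-Unique mp = Unique-++⁻ _ (Unique-resp-↭ (↭-sym (splits-↭ R mp)) u)
  x∉α : ∀ {p α} → p ∈ splits R → α ∈ arrangements f (proj₁ p) → x ∉ α
  x∉α {p} mp mα z = Unique.Unique[x∷xs]⇒x∉xs (x∉ ∷ u)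
    (proj₁ (splits-⊆ R mp) (∈-resp-↭ (arrangements-↭ f (proj₁ p) mα) z))
  aroundUnique : ∀ {p} → p ∈ splits R →
    Unique (concatMap (λ α → map (λ β → α ++ x ∷ β) (arrangements f (proj₂ p))) (arrangements f (proj₁ p)))
  aroundUnique {p} mp = Unique-concatMap _ (arrangements f (proj₁ p))
      (arrangements-Unique f (proj₁ p) (proj₁ (parts-Unique mp)))
      (λ {α} _ → Unique.map⁺ (λ e → proj₂ (∷-injective (++-cancelˡ α _ _ e)))
                   (arrangements-Unique f (proj₂ p) (proj₂ (parts-Unique mp))))
      sameLeft
    where
    sameLeft : ∀ {α α' y} → α ∈ arrangements f (proj₁ p) → α' ∈ arrangements f (proj₁ p) →
      y ∈ map (λ β → α ++ x ∷ β) (arrangements f (proj₂ p)) → y ∈ map (λ β → α' ++ x ∷ β) (arrangements f (proj₂ p)) → α ≡ α'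
    sameLeft {α} {α'} mα mα' y₁ y₂ with ∈-map⁻ (λ β → α ++ x ∷ β) y₁ | ∈-map⁻ (λ β → α' ++ x ∷ β) y₂
    ... | β , _ , refl | β' , _ , e = proj₁ (++-∷-injective α α' (x∉α mp mα) (x∉α mp mα') e)
  samePart : ∀ {p p' y} → p ∈ splits R → p' ∈ splits R → y ∈ _ → y ∈ _ → p ≡ p'
  samePart {p} {p'} mp mp' y₁ y₂
    with ∈-concatMap⁻′ _ (arrangements f (proj₁ p)) y₁ | ∈-concatMap⁻′ _ (arrangements f (proj₁ p')) y₂
  ... | α , mα , z₁ | α' , mα' , z₂ with ∈-map⁻ (λ β → α ++ x ∷ β) z₁ | ∈-map⁻ (λ β → α' ++ x ∷ β) z₂
  ... | β , _ , refl | β' , _ , e with proj₁ (++-∷-injective α α' (x∉α mp mα) (x∉α mp' mα') e)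
  ... | refl = splits-injective R u mp mp'
        (λ z → ∈-resp-↭ (arrangements-↭ f (proj₁ p') mα') (∈-resp-↭ (↭-sym (arrangements-↭ f (proj₁ p) mα)) z))
        (λ z → ∈-resp-↭ (arrangements-↭ f (proj₁ p) mα) (∈-resp-↭ (↭-sym (arrangements-↭ f (proj₁ p') mα')) z))

-- perms n as a reordering of arrangements n [1, …, n]

range : ℕ → ℕ → List ℕ
range a zero    = []
range a (suc n) = a ∷ range (suc a) n

length-range : ∀ a n → length (range a n) ≡ n
length-range a zero    = refl
length-range a (suc n) = cong suc (length-range (suc a) n)

range-≥ : ∀ a n → All (a ≤_) (range a n)
range-≥ a zero    = []
range-≥ a (suc n) = ≤-refl ∷ All.map (≤-trans (n≤1+n a)) (range-≥ (suc a) n)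

range-sorted : ∀ a n → AllPairs _<_ (range a n)
range-sorted a zero    = []
range-sorted a (suc n) = range-≥ (suc a) n ∷ range-sorted (suc a) n

sorted⇒Unique : ∀ {xs} → AllPairs _<_ xs → Unique xs
sorted⇒Unique = AllPairs.map <⇒≢

map-suc-upTo≡range : ∀ n → map suc (upTo n) ≡ range 1 n
map-suc-upTo≡range n = go n (λ i → i) 0 (λ _ → refl)
  where
  go : ∀ n (h : ℕ → ℕ) a → (∀ i → h i ≡ a + i) → map suc (applyUpTo h n) ≡ range (suc a) n
  go zero    h a eq = refl
  go (suc n) h a eq = cong₂ _∷_ (cong suc (trans (eq 0) (+-identityʳ a)))
    (go n (h ∘ suc) (suc a) (λ i → trans (eq (suc i)) (+-suc a i)))

∈-words⁻ : ∀ n m {π} → π ∈ words n m → length π ≡ m × All (_∈ range 1 n) π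
∈-words⁻ n zero    (here refl) = refl , []
∈-words⁻ n (suc m) mem with ∈-concatMap⁻′ _ (words n m) mem
... | w , mw , m₂ with ∈-map⁻ (λ a → a ∷ w) m₂
... | a , ma , refl with ∈-words⁻ n m mw
... | l , al = cong suc l , subst (a ∈_) (map-suc-upTo≡range n) ma ∷ al

∈-words⁺ : ∀ n m π → length π ≡ m → All (_∈ range 1 n) π → π ∈ words n m
∈-words⁺ n zero    []      _ _          = here refl
∈-words⁺ n (suc m) (a ∷ π) l (ma ∷ al) =
  ∈-concatMap⁺′ _ (∈-words⁺ n m π (suc-injective l) al)
    (∈-map⁺ (λ a → a ∷ π) (subst (a ∈_) (sym (map-suc-upTo≡range n)) ma))

words-Unique : ∀ n m → Unique (words n m)
words-Unique n zero    = [] ∷ []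
words-Unique n (suc m) = Unique-concatMap _ (words n m) (words-Unique n m)
  (λ _ → Unique.map⁺ (proj₁ ∘ ∷-injective) (Unique.map⁺ suc-injective (Unique.upTo⁺ n)))
  sameTail
  where
  sameTail : ∀ {w w' y} → w ∈ words n m → w' ∈ words n m →
    y ∈ map (λ a → a ∷ w) (map suc (upTo n)) → y ∈ map (λ a → a ∷ w') (map suc (upTo n)) → w ≡ w'
  sameTail {w} {w'} _ _ y₁ y₂ with ∈-map⁻ (λ a → a ∷ w) y₁ | ∈-map⁻ (λ a → a ∷ w') y₂
  ... | a , _ , refl | a' , _ , e = proj₂ (∷-injective e)

elemᵇ⇒∈ : ∀ a xs → T (elemᵇ a xs) → a ∈ xs
elemᵇ⇒∈ a (x ∷ xs) t with a ≡ᵇ x in eq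
... | true  = here (≡ᵇ⇒≡ a x (subst T (sym eq) tt))
... | false = there (elemᵇ⇒∈ a xs t)

∈⇒elemᵇ : ∀ a xs → a ∈ xs → T (elemᵇ a xs)
∈⇒elemᵇ a (x ∷ xs) (here refl) with a ≡ᵇ x in eq
... | true  = tt
... | false = ⊥-elim (subst T eq (≡⇒≡ᵇ a a refl))
∈⇒elemᵇ a (x ∷ xs) (there m) with a ≡ᵇ x
... | true  = tt
... | false = ∈⇒elemᵇ a xs m

distinctᵇ⇒Unique : ∀ xs → T (distinctᵇ xs) → Unique xs
distinctᵇ⇒Unique []       _ = []
distinctᵇ⇒Unique (x ∷ xs) t with elemᵇ x xs in eq
... | false = All.tabulate (λ {z} mz e → subst T eq (∈⇒elemᵇ x xs (subst (_∈ xs) (sym e) mz))) ∷ distinctᵇ⇒Unique xs t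

Unique⇒distinctᵇ : ∀ xs → Unique xs → T (distinctᵇ xs)
Unique⇒distinctᵇ []       _        = tt
Unique⇒distinctᵇ (x ∷ xs) (x∉ ∷ u) with elemᵇ x xs in eq
... | false = Unique⇒distinctᵇ xs u
... | true  = Unique.Unique[x∷xs]⇒x∉xs (x∉ ∷ u) (elemᵇ⇒∈ x xs (subst T (sym eq) tt))

∈-resp-remove : ∀ {s z : ℕ} S₁ {S₂} → z ∈ S₁ ++ s ∷ S₂ → z ≢ s → z ∈ S₁ ++ S₂
∈-resp-remove S₁ m z≢s with ∈-++⁻ S₁ m
... | inj₁ m₁         = ∈-++⁺ˡ m₁
... | inj₂ (here e)   = ⊥-elim (z≢s e)
... | inj₂ (there m₂) = ∈-++⁺ʳ S₁ m₂

length-remove : ∀ (S₁ : List ℕ) {s S₂} → length (S₁ ++ s ∷ S₂) ≡ suc (length (S₁ ++ S₂))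
length-remove S₁ {s} {S₂} = trans (length-++ S₁) (trans (+-suc (length S₁) (length S₂)) (cong suc (sym (length-++ S₁))))

Unique-⊆⇒length-≤ : ∀ (π S : List ℕ) → Unique π → π ⊆ S → length π ≤ length S
Unique-⊆⇒length-≤ []      S _        _   = z≤n
Unique-⊆⇒length-≤ (p ∷ π) S (p∉ ∷ u) sub with ∈-∃++ (sub (here refl))
... | S₁ , S₂ , refl = subst (suc (length π) ≤_) (sym (length-remove S₁))
  (s≤s (Unique-⊆⇒length-≤ π (S₁ ++ S₂) u (λ mz → ∈-resp-remove S₁ (sub (there mz)) (All.lookup p∉ mz ∘ sym))))

Unique-⊆-length⇒⊇ : ∀ (π S : List ℕ) → Unique π → π ⊆ S → length S ≤ length π → S ⊆ π
Unique-⊆-length⇒⊇ π S u sub le {s} ms with s ∈? π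
... | yes m  = m
... | no s∉π with ∈-∃++ ms
... | S₁ , S₂ , refl = ⊥-elim (<-irrefl refl (≤-trans
  (s≤s (Unique-⊆⇒length-≤ π (S₁ ++ S₂) u (λ mz → ∈-resp-remove S₁ (sub mz) (λ { refl → s∉π mz }))))
  (subst (_≤ length π) (length-remove S₁) le)))

perms-Unique : ∀ n → Unique (perms n)
perms-Unique n = Unique.filter⁺ (λ w → T? (distinctᵇ w)) (words-Unique n n)

∈-perms⇒↭ : ∀ n {π} → π ∈ perms n → π ↭ range 1 n
∈-perms⇒↭ n {π} m with ∈-filter⁻ (λ w → T? (distinctᵇ w)) {xs = words n n} m
... | mw , t with ∈-words⁻ n n mw
... | l , al = ∼bag⇒↭ (unique∧set⇒bag u (sorted⇒Unique (range-sorted 1 n))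
    (mk⇔ (All.lookup al) (Unique-⊆-length⇒⊇ π (range 1 n) u (All.lookup al)
      (≤-reflexive (trans (length-range 1 n) (sym l))))))
  where
  u : Unique π
  u = distinctᵇ⇒Unique π t

↭⇒∈-perms : ∀ n {π} → π ↭ range 1 n → π ∈ perms n
↭⇒∈-perms n {π} q = ∈-filter⁺ (λ w → T? (distinctᵇ w)) {xs = words n n}
  (∈-words⁺ n n π (trans (↭-length q) (length-range 1 n)) (All.tabulate (∈-resp-↭ q)))
  (Unique⇒distinctᵇ π (Unique-resp-↭ (↭-sym q) (sorted⇒Unique (range-sorted 1 n))))

perms↭arrangements : ∀ n f → n ≤ f → perms n ↭ arrangements f (range 1 n)
perms↭arrangements n f le = ∼bag⇒↭ (unique∧set⇒bag (perms-Unique n)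
  (arrangements-Unique f (range 1 n) (sorted⇒Unique (range-sorted 1 n)))
  (mk⇔ (arrangements-complete f (range 1 n) (subst (_≤ f) (sym (length-range 1 n)) le) ∘ ∈-perms⇒↭ n)
       (↭⇒∈-perms n ∘ arrangements-↭ f (range 1 n))))

-- Statistics that only depend on the relative order of the entries

OrderMatching : (ℕ → ℕ → Set) → Set
OrderMatching R = ∀ {a b a' b'} → R a b → R a' b' → (a <ᵇ a') ≡ (b <ᵇ b')

OrderInvariant : (List ℕ → Bool) → Set₁
OrderInvariant q = ∀ {R} → OrderMatching R → ∀ {π σ} → Pointwise R π σ → q π ≡ q σ

nullᵇ : List ℕ → Bool
nullᵇ []      = true
nullᵇ (_ ∷ _) = false

isIncreasingWithRuns : ℕ → List ℕ → Bool
isIncreasingWithRuns k π = isIncreasingᵇ π ∧ (runs π ≡ᵇ k)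

isValleyFreeWithDescents : ℕ → List ℕ → Bool
isValleyFreeWithDescents d α = nullᵇ (valleyHeights α) ∧ (descents α ≡ᵇ d)

module _ {R : ℕ → ℕ → Set} (R-matching : OrderMatching R) where

  valleyHeights-pointwise : ∀ {π σ} → Pointwise R π σ → Pointwise R (valleyHeights π) (valleyHeights σ)
  valleyHeights-pointwise []                 = []
  valleyHeights-pointwise (_ ∷ [])           = []
  valleyHeights-pointwise (_ ∷ _ ∷ [])       = []
  valleyHeights-pointwise (ra ∷ rb ∷ rc ∷ r) =
    if-pointwise (R-matching rb ra) (R-matching rb rc) rb (valleyHeights-pointwise (rb ∷ rc ∷ r))
    where
    if-pointwise : ∀ {b b' t₁ t₁' t₂ t₂' L L'} → t₁ ≡ t₁' → t₂ ≡ t₂' → R b b' → Pointwise R L L' →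
      Pointwise R (if t₁ ∧ t₂ then b ∷ L else L) (if t₁' ∧ t₂' then b' ∷ L' else L')
    if-pointwise {t₁ = true}  {t₂ = true}  refl refl rb p = rb ∷ p
    if-pointwise {t₁ = true}  {t₂ = false} refl refl rb p = p
    if-pointwise {t₁ = false}              refl refl rb p = p

  strictlyIncᵇ-pointwise : ∀ {π σ} → Pointwise R π σ → strictlyIncᵇ π ≡ strictlyIncᵇ σ
  strictlyIncᵇ-pointwise []            = refl
  strictlyIncᵇ-pointwise (_ ∷ [])      = refl
  strictlyIncᵇ-pointwise (ra ∷ rb ∷ r) = cong₂ _∧_ (R-matching ra rb) (strictlyIncᵇ-pointwise (rb ∷ r))

  descents-pointwise : ∀ {π σ} → Pointwise R π σ → descents π ≡ descents σ
  descents-pointwise []            = refl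
  descents-pointwise (_ ∷ [])      = refl
  descents-pointwise (ra ∷ rb ∷ r) =
    cong₂ _+_ (cong (λ t → if t then 1 else 0) (R-matching rb ra)) (descents-pointwise (rb ∷ r))

  runs-pointwise : ∀ {π σ} → Pointwise R π σ → runs π ≡ runs σ
  runs-pointwise []       = refl
  runs-pointwise (r ∷ rs) = cong suc (descents-pointwise (r ∷ rs))

  nullᵇ-pointwise : ∀ {π σ} → Pointwise R π σ → nullᵇ π ≡ nullᵇ σ
  nullᵇ-pointwise []      = refl
  nullᵇ-pointwise (_ ∷ _) = refl

isIncreasingWithRuns-invariant : ∀ k → OrderInvariant (isIncreasingWithRuns k)
isIncreasingWithRuns-invariant k R-matching p =
  cong₂ _∧_ (strictlyIncᵇ-pointwise R-matching (valleyHeights-pointwise R-matching p))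
            (cong (_≡ᵇ k) (runs-pointwise R-matching p))

concatMap-pointwise : ∀ {A B C D : Set} {S : A → B → Set} {S' : C → D → Set} {g : A → List C} {h : B → List D} {xs ys} →
  Pointwise S xs ys → (∀ {x y} → S x y → Pointwise S' (g x) (h y)) → Pointwise S' (concatMap g xs) (concatMap h ys)
concatMap-pointwise []       gh = []
concatMap-pointwise (r ∷ rs) gh = Pointwise.++⁺ (gh r) (concatMap-pointwise rs gh)

module _ {R : ℕ → ℕ → Set} where

  SplitPointwise : Split → Split → Set
  SplitPointwise p p' = Pointwise R (proj₁ p) (proj₁ p') × Pointwise R (proj₂ p) (proj₂ p')

  splits-pointwise : ∀ {A B} → Pointwise R A B → Pointwise SplitPointwise (splits A) (splits B)
  splits-pointwise []       = ([] , []) ∷ []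
  splits-pointwise (r ∷ rs) = Pointwise.++⁺
    (Pointwise.map⁺ _ _ (Pointwise.map (λ (p₁ , p₂) → r ∷ p₁ , p₂) (splits-pointwise rs)))
    (Pointwise.map⁺ _ _ (Pointwise.map (λ (p₁ , p₂) → p₁ , r ∷ p₂) (splits-pointwise rs)))

  arrangements-pointwise : ∀ f {A B} → Pointwise R A B → Pointwise (Pointwise R) (arrangements f A) (arrangements f B)
  arrangements-pointwise f       []       = [] ∷ []
  arrangements-pointwise zero    (r ∷ rs) = []
  arrangements-pointwise (suc f) (r ∷ rs) = concatMap-pointwise (splits-pointwise rs) λ (p₁ , p₂) →
    concatMap-pointwise (arrangements-pointwise f p₁) λ pα →
      Pointwise.map⁺ _ _ (Pointwise.map (λ pβ → Pointwise.++⁺ pα (r ∷ pβ)) (arrangements-pointwise f p₂))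

count-pointwise : ∀ {q R} → OrderInvariant q → OrderMatching R → ∀ {L M} → Pointwise (Pointwise R) L M → count q L ≡ count q M
count-pointwise q-inv R-matching []       = refl
count-pointwise q-inv R-matching (r ∷ rs) = cong₂ _+_ (cong 𝟙 (q-inv R-matching r)) (count-pointwise q-inv R-matching rs)

Matched : List ℕ → List ℕ → ℕ → ℕ → Set
Matched (x ∷ A) (y ∷ B) a b = (a ≡ x × b ≡ y) ⊎ Matched A B a b
Matched _       _       a b = ⊥

Matched-∈ : ∀ A B {a b} → Matched A B a b → a ∈ A × b ∈ B
Matched-∈ (x ∷ A) (y ∷ B) (inj₁ (refl , refl)) = here refl , here refl
Matched-∈ (x ∷ A) (y ∷ B) (inj₂ z)             = map₁ there (map₂ there (Matched-∈ A B z))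

Matched-pointwise : ∀ A B → length A ≡ length B → Pointwise (Matched A B) A B
Matched-pointwise []      []      _ = []
Matched-pointwise (x ∷ A) (y ∷ B) e = inj₁ (refl , refl) ∷ Pointwise.map inj₂ (Matched-pointwise A B (suc-injective e))

<⇒<ᵇ≡true : ∀ {m n} → m < n → (m <ᵇ n) ≡ true
<⇒<ᵇ≡true {m} {n} lt with m <ᵇ n in eq
... | true  = refl
... | false = ⊥-elim (subst T eq (<⇒<ᵇ lt))

≥⇒<ᵇ≡false : ∀ {m n} → n ≤ m → (m <ᵇ n) ≡ false
≥⇒<ᵇ≡false {m} {n} le with m <ᵇ n in eq
... | false = refl
... | true  = ⊥-elim (<⇒≱ (<ᵇ⇒< m n (subst T (sym eq) tt)) le)

Matched-orderMatching : ∀ A B → AllPairs _<_ A → AllPairs _<_ B → OrderMatching (Matched A B)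
Matched-orderMatching (x ∷ A) (y ∷ B) _ _ (inj₁ (refl , refl)) (inj₁ (refl , refl)) =
  trans (≥⇒<ᵇ≡false {x} ≤-refl) (sym (≥⇒<ᵇ≡false {y} ≤-refl))
Matched-orderMatching (x ∷ A) (y ∷ B) (x< ∷ _) (y< ∷ _) (inj₁ (refl , refl)) (inj₂ z) =
  trans (<⇒<ᵇ≡true (All.lookup x< (proj₁ (Matched-∈ A B z)))) (sym (<⇒<ᵇ≡true (All.lookup y< (proj₂ (Matched-∈ A B z)))))
Matched-orderMatching (x ∷ A) (y ∷ B) (x< ∷ _) (y< ∷ _) (inj₂ z) (inj₁ (refl , refl)) =
  trans (≥⇒<ᵇ≡false (<⇒≤ (All.lookup x< (proj₁ (Matched-∈ A B z)))))
        (sym (≥⇒<ᵇ≡false (<⇒≤ (All.lookup y< (proj₂ (Matched-∈ A B z))))))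
Matched-orderMatching (x ∷ A) (y ∷ B) (_ ∷ sA) (_ ∷ sB) (inj₂ z) (inj₂ z') = Matched-orderMatching A B sA sB z z'

count-perms≡count-arrangements : ∀ q n f → n ≤ f → count q (perms n) ≡ count q (arrangements f (range 1 n))
count-perms≡count-arrangements q n f le = sumBy-↭ _ (perms↭arrangements n f le)

-- The relabelling A ≅ [1, …, length A] preserves relative order.
count-arrangements-sorted : ∀ q → OrderInvariant q → ∀ f A → AllPairs _<_ A → length A ≤ f →
  count q (arrangements f A) ≡ count q (perms (length A))
count-arrangements-sorted q q-inv f A sorted le =
  trans (count-pointwise q-inv (Matched-orderMatching A (range 1 s) sorted (range-sorted 1 s))
          (arrangements-pointwise f (Matched-pointwise A (range 1 s) (sym (length-range 1 s)))))
        (sym (count-perms≡count-arrangements q s f le))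
  where s = length A

incRun≡count : ∀ n k → incRun n k ≡ count (isIncreasingWithRuns k) (perms n)
incRun≡count n k = length-filter≡count (isIncreasingWithRuns k) (perms n)

-- Inserting an entry below all others

module _ {x : ℕ} where

  valleyHeights-min∷ : ∀ β → All (x <_) β → valleyHeights (x ∷ β) ≡ valleyHeights β
  valleyHeights-min∷ []          _        = refl
  valleyHeights-min∷ (b ∷ [])    _        = refl
  valleyHeights-min∷ (b ∷ c ∷ β) (x<b ∷ _) rewrite ≥⇒<ᵇ≡false {b} {x} (<⇒≤ x<b) = refl

  descents-min∷ : ∀ β → All (x <_) β → descents (x ∷ β) ≡ descents β
  descents-min∷ []      _         = refl
  descents-min∷ (b ∷ β) (x<b ∷ _) rewrite ≥⇒<ᵇ≡false {b} {x} (<⇒≤ x<b) = refl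

  -- x is a valley of α ++ x ∷ β exactly when α and β are both nonempty.
  valleyHeightsFrom : List ℕ → List ℕ
  valleyHeightsFrom []      = []
  valleyHeightsFrom (b ∷ β) = x ∷ valleyHeights (b ∷ β)

  valleyHeights-++-min : ∀ a α β → All (x <_) (a ∷ α) → All (x <_) β →
    valleyHeights ((a ∷ α) ++ x ∷ β) ≡ valleyHeights (a ∷ α) ++ valleyHeightsFrom β
  valleyHeights-++-min a []       []      _           _ = refl
  valleyHeights-++-min a []       (b ∷ β) (x<a ∷ [])  (x<b ∷ x<β)
    rewrite <⇒<ᵇ≡true x<a | <⇒<ᵇ≡true x<b = cong (x ∷_) (valleyHeights-min∷ (b ∷ β) (x<b ∷ x<β))
  valleyHeights-++-min a (a' ∷ []) β (_ ∷ x<a' ∷ []) x<β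
    rewrite ≥⇒<ᵇ≡false {a'} {x} (<⇒≤ x<a') | ∧-zeroʳ (a' <ᵇ a) = valleyHeights-++-min a' [] β (x<a' ∷ []) x<β
  valleyHeights-++-min a (a' ∷ c ∷ α) β (_ ∷ x<α) x<β =
    if-∷-++ ((a' <ᵇ a) ∧ (a' <ᵇ c)) (valleyHeights-++-min a' (c ∷ α) β x<α x<β)
    where
    if-∷-++ : ∀ t {L L' M : List ℕ} {y} → L ≡ L' ++ M → (if t then y ∷ L else L) ≡ (if t then y ∷ L' else L') ++ M
    if-∷-++ true  e = cong (_ ∷_) e
    if-∷-++ false e = e

  descents-++-min : ∀ a α β → All (x <_) (a ∷ α) → All (x <_) β →
    descents ((a ∷ α) ++ x ∷ β) ≡ descents (a ∷ α) + suc (descents β)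
  descents-++-min a []       β (x<a ∷ []) x<β rewrite <⇒<ᵇ≡true x<a = cong suc (descents-min∷ β x<β)
  descents-++-min a (a' ∷ α) β (_ ∷ x<α)  x<β =
    trans (cong (d +_) (descents-++-min a' α β x<α x<β)) (sym (+-assoc d _ _))
    where d = if a' <ᵇ a then 1 else 0

  strictlyIncᵇ-++-min : ∀ l m → All (x <_) l → All (x <_) m → strictlyIncᵇ (l ++ x ∷ m) ≡ nullᵇ l ∧ strictlyIncᵇ m
  strictlyIncᵇ-++-min []           []      _           _           = refl
  strictlyIncᵇ-++-min []           (c ∷ m) _           (x<c ∷ _)   rewrite <⇒<ᵇ≡true x<c = refl
  strictlyIncᵇ-++-min (a ∷ [])     m       (x<a ∷ [])  _           rewrite ≥⇒<ᵇ≡false {a} {x} (<⇒≤ x<a) = refl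
  strictlyIncᵇ-++-min (a ∷ a' ∷ l) m       (_ ∷ x<l)   x<m =
    trans (cong ((a <ᵇ a') ∧_) (strictlyIncᵇ-++-min (a' ∷ l) m x<l x<m)) (∧-zeroʳ (a <ᵇ a'))

valleyHeights-All : ∀ {P : ℕ → Set} l → All P l → All P (valleyHeights l)
valleyHeights-All []              _              = []
valleyHeights-All (a ∷ [])        _              = []
valleyHeights-All (a ∷ b ∷ [])    _              = []
valleyHeights-All {P} (a ∷ b ∷ c ∷ l) (_ ∷ pb ∷ pl) =
  All-if ((b <ᵇ a) ∧ (b <ᵇ c)) pb (valleyHeights-All (b ∷ c ∷ l) (pb ∷ pl))
  where
  All-if : ∀ t {L y} → P y → All P L → All P (if t then y ∷ L else L)
  All-if true  py pL = py ∷ pL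
  All-if false py pL = pL

nullᵇ-++-∷ : ∀ l {y m} → nullᵇ (l ++ y ∷ m) ≡ false
nullᵇ-++-∷ []      = refl
nullᵇ-++-∷ (_ ∷ _) = refl

suc+-≡ᵇ : ∀ m e k → (m + suc e ≡ᵇ k) ≡ (suc e ≡ᵇ k ∸ m)
suc+-≡ᵇ zero    e k       = refl
suc+-≡ᵇ (suc m) e zero    = refl
suc+-≡ᵇ (suc m) e (suc k) = suc+-≡ᵇ m e k

module _ {x : ℕ} where

  isIncreasingWithRuns-min∷ : ∀ k b β → All (x <_) (b ∷ β) →
    isIncreasingWithRuns k (x ∷ b ∷ β) ≡ isIncreasingWithRuns k (b ∷ β)
  isIncreasingWithRuns-min∷ k b β x<β rewrite valleyHeights-min∷ (b ∷ β) x<β | descents-min∷ (b ∷ β) x<β = refl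

  isIncreasingWithRuns-∷ʳ-min : ∀ k a α → All (x <_) (a ∷ α) →
    isIncreasingWithRuns (suc k) ((a ∷ α) ++ x ∷ []) ≡ isIncreasingWithRuns k (a ∷ α)
  isIncreasingWithRuns-∷ʳ-min k a α x<α
    rewrite valleyHeights-++-min a α [] x<α [] | ++-identityʳ (valleyHeights (a ∷ α))
          | descents-++-min a α [] x<α [] | +-comm (descents (a ∷ α)) 1 = refl

  -- x is the first valley, so the valleys of α must be absent.
  isIncreasingWithRuns-++-min : ∀ k a α b β → All (x <_) (a ∷ α) → All (x <_) (b ∷ β) →
    isIncreasingWithRuns k ((a ∷ α) ++ x ∷ b ∷ β)
      ≡ nullᵇ (valleyHeights (a ∷ α)) ∧ isIncreasingWithRuns (k ∸ suc (descents (a ∷ α))) (b ∷ β)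
  isIncreasingWithRuns-++-min k a α b β x<α x<β
    rewrite valleyHeights-++-min a α (b ∷ β) x<α x<β | descents-++-min a α (b ∷ β) x<α x<β
          | strictlyIncᵇ-++-min (valleyHeights (a ∷ α)) (valleyHeights (b ∷ β))
              (valleyHeights-All (a ∷ α) x<α) (valleyHeights-All (b ∷ β) x<β)
          | suc+-≡ᵇ (suc (descents (a ∷ α))) (descents (b ∷ β)) k
    = ∧-assoc (nullᵇ (valleyHeights (a ∷ α))) _ _

  isValleyFreeWithDescents-min∷ : ∀ d b β → All (x <_) (b ∷ β) →
    isValleyFreeWithDescents d (x ∷ b ∷ β) ≡ isValleyFreeWithDescents d (b ∷ β)
  isValleyFreeWithDescents-min∷ d b β x<β rewrite valleyHeights-min∷ (b ∷ β) x<β | descents-min∷ (b ∷ β) x<β = refl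

  isValleyFreeWithDescents-∷ʳ-min : ∀ d a α → All (x <_) (a ∷ α) →
    isValleyFreeWithDescents (suc d) ((a ∷ α) ++ x ∷ []) ≡ isValleyFreeWithDescents d (a ∷ α)
  isValleyFreeWithDescents-∷ʳ-min d a α x<α
    rewrite valleyHeights-++-min a α [] x<α [] | ++-identityʳ (valleyHeights (a ∷ α))
          | descents-++-min a α [] x<α [] | +-comm (descents (a ∷ α)) 1 = refl

  isValleyFreeWithDescents-∷ʳ-min-0 : ∀ a α → All (x <_) (a ∷ α) →
    isValleyFreeWithDescents 0 ((a ∷ α) ++ x ∷ []) ≡ false
  isValleyFreeWithDescents-∷ʳ-min-0 a α x<α
    rewrite descents-++-min a α [] x<α [] | +-comm (descents (a ∷ α)) 1 = ∧-zeroʳ _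

  isValleyFreeWithDescents-++-min : ∀ d a α b β → All (x <_) (a ∷ α) → All (x <_) (b ∷ β) →
    isValleyFreeWithDescents d ((a ∷ α) ++ x ∷ b ∷ β) ≡ false
  isValleyFreeWithDescents-++-min d a α b β x<α x<β
    rewrite valleyHeights-++-min a α (b ∷ β) x<α x<β | nullᵇ-++-∷ (valleyHeights (a ∷ α)) {x} {valleyHeights (b ∷ β)} = refl

-- Counting arrangements by the position of their minimum

sumBy-splits : ∀ R (H : ℕ → ℕ → ℕ) → sumBy (λ p → H (length (proj₁ p)) (length (proj₂ p))) (splits R)
  ≡ sumBelow (suc (length R)) (λ i → (length R C i) * H i (length R ∸ i))
sumBy-splits []      H = cong (_+ 0) (sym (*-identityˡ (H 0 0)))
sumBy-splits (y ∷ R) H = begin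
    sumBy F (map (map₁ (y ∷_)) S ++ map (map₂ (y ∷_)) S)
  ≡⟨ sumBy-++ F (map (map₁ (y ∷_)) S) _ ⟩
    sumBy F (map (map₁ (y ∷_)) S) + sumBy F (map (map₂ (y ∷_)) S)
  ≡⟨ cong₂ _+_ (sumBy-map F (map₁ (y ∷_)) S) (sumBy-map F (map₂ (y ∷_)) S) ⟩
    sumBy (λ p → H (suc (length (proj₁ p))) (length (proj₂ p))) S + sumBy (λ p → H (length (proj₁ p)) (suc (length (proj₂ p)))) S
  ≡⟨ cong₂ _+_ (sumBy-splits R (H ∘ suc)) (sumBy-splits R (λ i j → H i (suc j))) ⟩
    Left + sumBelow (suc r) (λ i → (r C i) * H i (suc (r ∸ i)))
  ≡⟨ cong (λ s → Left + (A₀ + s)) (sumBelow-cong r (λ i i<r → cong (λ z → (r C suc i) * H (suc i) z) (sym (+-∸-assoc 1 i<r)))) ⟩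
    Left + (A₀ + Right)
  ≡⟨ x∙yz≈y∙xz Left (A₀) Right ⟩
    A₀ + (Left + Right)
  ≡⟨ cong (A₀ +_) (sym pascal) ⟩
    A₀ + sumBelow (suc r) (λ i → (suc r C suc i) * H (suc i) (r ∸ i)) ∎
  where
  open ≡-Reasoning
  S = splits R
  r = length R
  F : Split → ℕ
  F p = H (length (proj₁ p)) (length (proj₂ p))
  A₀    = 1 * H 0 (suc r)
  Left  = sumBelow (suc r) (λ i → (r C i) * H (suc i) (r ∸ i))
  Right = sumBelow r (λ i → (r C suc i) * H (suc i) (r ∸ i))
  pascal : sumBelow (suc r) (λ i → (suc r C suc i) * H (suc i) (r ∸ i)) ≡ Left + Right
  pascal = begin
      sumBelow (suc r) (λ i → (suc r C suc i) * H (suc i) (r ∸ i))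
    ≡⟨ sumBelow-cong (suc r) (λ i _ → trans (cong (_* H (suc i) (r ∸ i)) (sym (nCk+nC[k+1]≡[n+1]C[k+1] r i)))
                                             (*-distribʳ-+ (H (suc i) (r ∸ i)) (r C i) (r C suc i))) ⟩
      sumBelow (suc r) (λ i → (r C i) * H (suc i) (r ∸ i) + (r C suc i) * H (suc i) (r ∸ i))
    ≡⟨ sumBelow-+ (suc r) (λ i → (r C i) * H (suc i) (r ∸ i)) (λ i → (r C suc i) * H (suc i) (r ∸ i)) ⟩
      Left + sumBelow (suc r) (λ i → (r C suc i) * H (suc i) (r ∸ i))
    ≡⟨ cong (Left +_) (sumBelow-suc r (λ i → (r C suc i) * H (suc i) (r ∸ i))) ⟩
      Left + (Right + (r C suc r) * H (suc r) (r ∸ r))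
    ≡⟨ cong (λ c → Left + (Right + c * H (suc r) (r ∸ r))) (k>n⇒nCk≡0 {r} {suc r} ≤-refl) ⟩
      Left + (Right + 0)
    ≡⟨ cong (Left +_) (+-identityʳ Right) ⟩
      Left + Right ∎

splits-sorted : ∀ R {p} → AllPairs _<_ R → p ∈ splits R → AllPairs _<_ (proj₁ p) × AllPairs _<_ (proj₂ p)
splits-sorted []      _          (here refl) = [] , []
splits-sorted (y ∷ R) (y< ∷ sR) m with ∈-splits⁻ {y} {R} m
... | inj₁ (p₀ , m₀ , refl) = (All.anti-mono (proj₁ (splits-⊆ R m₀)) y< ∷ proj₁ (splits-sorted R sR m₀)) , proj₂ (splits-sorted R sR m₀)
... | inj₂ (p₀ , m₀ , refl) = proj₁ (splits-sorted R sR m₀) , (All.anti-mono (proj₂ (splits-⊆ R m₀)) y< ∷ proj₂ (splits-sorted R sR m₀))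

count-arrangements-∷ : ∀ q f x R → count q (arrangements (suc f) (x ∷ R)) ≡
  sumBy (λ p → sumBy (λ α → count (λ β → q (α ++ x ∷ β)) (arrangements f (proj₂ p))) (arrangements f (proj₁ p))) (splits R)
count-arrangements-∷ q f x R =
  trans (sumBy-concatMap _ _ (splits R)) (sumBy-cong (splits R) λ {p} _ →
    trans (sumBy-concatMap _ _ (arrangements f (proj₁ p))) (sumBy-cong (arrangements f (proj₁ p)) λ {α} _ →
      sumBy-map _ (λ β → α ++ x ∷ β) (arrangements f (proj₂ p))))

-- When the count for a split only depends on the sizes of its parts, the C(|R|, i) splits
-- with a left part of size i all contribute alike.
count-arrangements-sizes : ∀ q f x R (H : ℕ → ℕ → ℕ) → AllPairs _<_ R → All (x <_) R → length R ≤ f →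
  (∀ A B → AllPairs _<_ A → AllPairs _<_ B → All (x <_) A → All (x <_) B → length A ≤ f → length B ≤ f →
     sumBy (λ α → count (λ β → q (α ++ x ∷ β)) (arrangements f B)) (arrangements f A) ≡ H (length A) (length B)) →
  count q (arrangements (suc f) (x ∷ R)) ≡ sumBelow (suc (length R)) (λ i → (length R C i) * H i (length R ∸ i))
count-arrangements-sizes q f x R H sR x<R le bySize = begin
    count q (arrangements (suc f) (x ∷ R))
  ≡⟨ count-arrangements-∷ q f x R ⟩
    sumBy _ (splits R)
  ≡⟨ sumBy-cong (splits R) (λ {p} mp → bySize (proj₁ p) (proj₂ p)
        (proj₁ (splits-sorted R sR mp)) (proj₂ (splits-sorted R sR mp))
        (All.anti-mono (proj₁ (splits-⊆ R mp)) x<R) (All.anti-mono (proj₂ (splits-⊆ R mp)) x<R)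
        (proj₁ (splits-length-≤ R mp le)) (proj₂ (splits-length-≤ R mp le))) ⟩
    sumBy (λ p → H (length (proj₁ p)) (length (proj₂ p))) (splits R)
  ≡⟨ sumBy-splits R H ⟩
    sumBelow (suc (length R)) (λ i → (length R C i) * H i (length R ∸ i)) ∎
  where open ≡-Reasoning

↭-∷⇒∷ : ∀ {π : List ℕ} {a A} → π ↭ a ∷ A → ∃[ a' ] ∃[ π' ] π ≡ a' ∷ π'
↭-∷⇒∷ {[]}     q with ↭-empty-inv (↭-sym q)
... | ()
↭-∷⇒∷ {a' ∷ π'} _ = a' , π' , refl

∈-arrangements-∷ : ∀ f {a A α} → α ∈ arrangements f (a ∷ A) → ∃[ a' ] ∃[ α' ] α ≡ a' ∷ α'
∈-arrangements-∷ f {a} {A} m = ↭-∷⇒∷ (arrangements-↭ f (a ∷ A) m)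

arrangements-All : ∀ {P : ℕ → Set} f {A α} → All P A → α ∈ arrangements f A → All P α
arrangements-All f {A} pA m = All-resp-↭ (↭-sym (arrangements-↭ f A m)) pA

valleyFreeSplitCount : ℕ → ℕ → ℕ → ℕ
valleyFreeSplitCount d       zero    zero    = 𝟙 (0 ≡ᵇ d)
valleyFreeSplitCount d       zero    (suc j) = j C d
valleyFreeSplitCount zero    (suc i) zero    = 0
valleyFreeSplitCount (suc d) (suc i) zero    = i C d
valleyFreeSplitCount d       (suc i) (suc j) = 0

valleyFreeSplitCount-both : ∀ d i j → 0 < j → valleyFreeSplitCount d (suc i) j ≡ 0
valleyFreeSplitCount-both zero    i (suc j) _ = refl
valleyFreeSplitCount-both (suc d) i (suc j) _ = refl

sumBelow-valleyFreeSplitCount : ∀ d r → sumBelow (suc r) (λ i → (r C i) * valleyFreeSplitCount d i (r ∸ i)) ≡ r C d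
sumBelow-valleyFreeSplitCount zero    zero    = refl
sumBelow-valleyFreeSplitCount (suc d) zero    = sym (k>n⇒nCk≡0 {0} {suc d} (s≤s z≤n))
sumBelow-valleyFreeSplitCount d       (suc r) = begin
    1 * (r C d) + sumBelow (suc r) F
  ≡⟨ cong₂ _+_ (*-identityˡ (r C d)) (sumBelow-suc r F) ⟩
    r C d + (sumBelow r F + F r)
  ≡⟨ cong (λ z → r C d + (z + F r)) (sumBelow-zero r F (λ i i<r →
       trans (cong ((suc r C suc i) *_) (valleyFreeSplitCount-both d i (r ∸ i) (m<n⇒0<n∸m i<r))) (*-zeroʳ (suc r C suc i)))) ⟩
    r C d + F r
  ≡⟨ cong (r C d +_) (trans (cong₂ _*_ (nCn≡1 (suc r)) (cong (valleyFreeSplitCount d (suc r)) (n∸n≡0 r))) (*-identityˡ _)) ⟩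
    r C d + valleyFreeSplitCount d (suc r) 0
  ≡⟨ pascal d ⟩
    suc r C d ∎
  where
  open ≡-Reasoning
  F : ℕ → ℕ
  F i = (suc r C suc i) * valleyFreeSplitCount d (suc i) (r ∸ i)
  pascal : ∀ d → r C d + valleyFreeSplitCount d (suc r) 0 ≡ suc r C d
  pascal zero    = refl
  pascal (suc d) = trans (+-comm (r C suc d) (r C d)) (nCk+nC[k+1]≡[n+1]C[k+1] r d)

-- The minimum of a valley-free arrangement is its first or its last entry.
count-valleyFree : ∀ f d a A → AllPairs _<_ (a ∷ A) → suc (length A) ≤ f →
  count (isValleyFreeWithDescents d) (arrangements f (a ∷ A)) ≡ length A C d
count-valleyFree (suc f) d a A (a< ∷ sA) (s≤s le) =
  trans (count-arrangements-sizes _ f a A (valleyFreeSplitCount d) sA a< le bySize)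
        (sumBelow-valleyFreeSplitCount d (length A))
  where
  bySize : ∀ A₁ B₁ → AllPairs _<_ A₁ → AllPairs _<_ B₁ → All (a <_) A₁ → All (a <_) B₁ → length A₁ ≤ f → length B₁ ≤ f →
    sumBy (λ α → count (λ β → isValleyFreeWithDescents d (α ++ a ∷ β)) (arrangements f B₁)) (arrangements f A₁)
      ≡ valleyFreeSplitCount d (length A₁) (length B₁)
  bySize []       []      _ _  _ _ _ _ = trans (+-identityʳ _) (+-identityʳ _)
  bySize []       (b ∷ B) _ sB _ a<B _ lB = trans (+-identityʳ _)
    (trans (count-cong (arrangements f (b ∷ B)) dropMin) (count-valleyFree f d b B sB lB))
    where
    dropMin : ∀ {β} → β ∈ arrangements f (b ∷ B) → isValleyFreeWithDescents d (a ∷ β) ≡ isValleyFreeWithDescents d β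
    dropMin m with ∈-arrangements-∷ f m
    ... | b' , β' , refl = isValleyFreeWithDescents-min∷ d b' β' (arrangements-All f a<B m)
  bySize (a₁ ∷ A₁) [] sA _ a<A _ lA _ = lastMin d
    where
    lastMin : ∀ d → sumBy (λ α → count (λ β → isValleyFreeWithDescents d (α ++ a ∷ β)) (arrangements f [])) (arrangements f (a₁ ∷ A₁))
      ≡ valleyFreeSplitCount d (suc (length A₁)) 0
    lastMin zero = sumBy-zero _ (arrangements f (a₁ ∷ A₁)) λ m → case ∈-arrangements-∷ f m of λ where
      (a' , α' , refl) → cong (λ t → 𝟙 t + 0) (isValleyFreeWithDescents-∷ʳ-min-0 a' α' (arrangements-All f a<A m))
    lastMin (suc d') = trans (sumBy-cong (arrangements f (a₁ ∷ A₁)) λ m → case ∈-arrangements-∷ f m of λ where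
        (a' , α' , refl) → trans (cong (λ t → 𝟙 t + 0) (isValleyFreeWithDescents-∷ʳ-min d' a' α' (arrangements-All f a<A m))) (+-identityʳ _))
      (count-valleyFree f d' a₁ A₁ sA lA)
  bySize (a₁ ∷ A₁) (b ∷ B) _ _ a<A a<B _ _ =
    trans (sumBy-zero _ (arrangements f (a₁ ∷ A₁)) inside) (sym (valleyFreeSplitCount-both d (length A₁) (suc (length B)) (s≤s z≤n)))
    where
    inside : ∀ {α} → α ∈ arrangements f (a₁ ∷ A₁) → count (λ β → isValleyFreeWithDescents d (α ++ a ∷ β)) (arrangements f (b ∷ B)) ≡ 0
    inside m with ∈-arrangements-∷ f m
    ... | a' , α' , refl = count-none _ (arrangements f (b ∷ B)) λ m' → case ∈-arrangements-∷ f m' of λ where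
      (b' , β' , refl) → isValleyFreeWithDescents-++-min d a' α' b' β' (arrangements-All f a<A m) (arrangements-All f a<B m')

descents-∷-≤ : ∀ a α → descents (a ∷ α) ≤ length α
descents-∷-≤ a []      = z≤n
descents-∷-≤ a (b ∷ α) with b <ᵇ a
... | true  = s≤s (descents-∷-≤ b α)
... | false = m≤n⇒m≤1+n (descents-∷-≤ b α)

sumBy-byDescents : ∀ (L : List (List ℕ)) D (g : ℕ → ℕ) → (∀ {α} → α ∈ L → descents α ≤ D) →
  sumBy (λ α → 𝟙 (nullᵇ (valleyHeights α)) * g (descents α)) L
    ≡ sumBelow (suc D) (λ d → count (isValleyFreeWithDescents d) L * g d)
sumBy-byDescents []      D g h = sym (sumBelow-zero (suc D) _ (λ _ _ → refl))
sumBy-byDescents (α ∷ L) D g h = begin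
    𝟙 (nullᵇ (valleyHeights α)) * g (descents α) + sumBy _ L
  ≡⟨ cong₂ _+_ (sym (single (nullᵇ (valleyHeights α)) refl)) (sumBy-byDescents L D g (h ∘ there)) ⟩
    sumBelow (suc D) (λ d → 𝟙 (isValleyFreeWithDescents d α) * g d) + sumBelow (suc D) (λ d → count (isValleyFreeWithDescents d) L * g d)
  ≡⟨ sym (sumBelow-+ (suc D) (λ d → 𝟙 (isValleyFreeWithDescents d α) * g d) (λ d → count (isValleyFreeWithDescents d) L * g d)) ⟩
    sumBelow (suc D) (λ d → 𝟙 (isValleyFreeWithDescents d α) * g d + count (isValleyFreeWithDescents d) L * g d)
  ≡⟨ sumBelow-cong (suc D) (λ d _ → sym (*-distribʳ-+ (g d) (𝟙 (isValleyFreeWithDescents d α)) (count (isValleyFreeWithDescents d) L))) ⟩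
    sumBelow (suc D) (λ d → count (isValleyFreeWithDescents d) (α ∷ L) * g d) ∎
  where
  open ≡-Reasoning
  single : ∀ t → nullᵇ (valleyHeights α) ≡ t →
    sumBelow (suc D) (λ d → 𝟙 (isValleyFreeWithDescents d α) * g d) ≡ 𝟙 t * g (descents α)
  single true  e rewrite e = trans (sumBelow-indicator (suc D) (descents α) g (s≤s (h (here refl)))) (sym (+-identityʳ _))
  single false e rewrite e = sumBelow-zero (suc D) _ (λ _ _ → refl)

increasingSplitCount : ℕ → ℕ → ℕ → ℕ
increasingSplitCount k' zero    zero    = 𝟙 (1 ≡ᵇ suc k')
increasingSplitCount k' zero    (suc j) = incRun (suc j) (suc k')
increasingSplitCount k' (suc i) zero    = incRun (suc i) k'
increasingSplitCount k' (suc i) (suc j) = sumBelow (suc i) (λ d → (i C d) * incRun (suc j) (suc k' ∸ suc d))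

count-increasing-sorted : ∀ f k B → AllPairs _<_ B → length B ≤ f →
  count (isIncreasingWithRuns k) (arrangements f B) ≡ incRun (length B) k
count-increasing-sorted f k B sB le =
  trans (count-arrangements-sorted _ (isIncreasingWithRuns-invariant k) f B sB le) (sym (incRun≡count (length B) k))

count-increasing : ∀ k' f x R → AllPairs _<_ R → All (x <_) R → length R ≤ f →
  count (isIncreasingWithRuns (suc k')) (arrangements (suc f) (x ∷ R))
    ≡ sumBelow (suc (length R)) (λ i → (length R C i) * increasingSplitCount k' i (length R ∸ i))
count-increasing k' f x R sR x<R le = count-arrangements-sizes _ f x R (increasingSplitCount k') sR x<R le bySize
  where
  k = suc k'
  bySize : ∀ A B → AllPairs _<_ A → AllPairs _<_ B → All (x <_) A → All (x <_) B → length A ≤ f → length B ≤ f →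
    sumBy (λ α → count (λ β → isIncreasingWithRuns k (α ++ x ∷ β)) (arrangements f B)) (arrangements f A)
      ≡ increasingSplitCount k' (length A) (length B)
  bySize []      []      _ _  _ _ _ _ = trans (+-identityʳ _) (+-identityʳ _)
  bySize []      (b ∷ B) _ sB _ x<B _ lB = trans (+-identityʳ _)
    (trans (count-cong (arrangements f (b ∷ B)) dropMin) (count-increasing-sorted f k (b ∷ B) sB lB))
    where
    dropMin : ∀ {β} → β ∈ arrangements f (b ∷ B) → isIncreasingWithRuns k (x ∷ β) ≡ isIncreasingWithRuns k β
    dropMin m with ∈-arrangements-∷ f m
    ... | b' , β' , refl = isIncreasingWithRuns-min∷ k b' β' (arrangements-All f x<B m)
  bySize (a ∷ A) [] sA _ x<A _ lA _ = trans (sumBy-cong (arrangements f (a ∷ A)) lastMin)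
    (count-increasing-sorted f k' (a ∷ A) sA lA)
    where
    lastMin : ∀ {α} → α ∈ arrangements f (a ∷ A) → 𝟙 (isIncreasingWithRuns k (α ++ x ∷ [])) + 0 ≡ 𝟙 (isIncreasingWithRuns k' α)
    lastMin m with ∈-arrangements-∷ f m
    ... | a' , α' , refl = trans (+-identityʳ _) (cong 𝟙 (isIncreasingWithRuns-∷ʳ-min k' a' α' (arrangements-All f x<A m)))
  bySize (a ∷ A) (b ∷ B) sA sB x<A x<B lA lB = begin
      sumBy (λ α → count (λ β → isIncreasingWithRuns k (α ++ x ∷ β)) (arrangements f (b ∷ B))) (arrangements f (a ∷ A))
    ≡⟨ sumBy-cong (arrangements f (a ∷ A)) splitAtMin ⟩
      sumBy (λ α → 𝟙 (nullᵇ (valleyHeights α)) * incRun (suc (length B)) (k ∸ suc (descents α))) (arrangements f (a ∷ A))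
    ≡⟨ sumBy-byDescents (arrangements f (a ∷ A)) (length A) (λ d → incRun (suc (length B)) (k ∸ suc d)) descents-≤ ⟩
      sumBelow (suc (length A)) (λ d → count (isValleyFreeWithDescents d) (arrangements f (a ∷ A)) * incRun (suc (length B)) (k ∸ suc d))
    ≡⟨ sumBelow-cong (suc (length A)) (λ d _ → cong (_* incRun (suc (length B)) (k ∸ suc d)) (count-valleyFree f d a A sA lA)) ⟩
      increasingSplitCount k' (suc (length A)) (suc (length B)) ∎
    where
    open ≡-Reasoning
    splitAtMin : ∀ {α} → α ∈ arrangements f (a ∷ A) → count (λ β → isIncreasingWithRuns k (α ++ x ∷ β)) (arrangements f (b ∷ B))
        ≡ 𝟙 (nullᵇ (valleyHeights α)) * incRun (suc (length B)) (k ∸ suc (descents α))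
    splitAtMin m with ∈-arrangements-∷ f m
    ... | a' , α' , refl = begin
        count (λ β → isIncreasingWithRuns k ((a' ∷ α') ++ x ∷ β)) (arrangements f (b ∷ B))
      ≡⟨ count-cong (arrangements f (b ∷ B)) (λ m' → case ∈-arrangements-∷ f m' of λ where
           (b' , β' , refl) → isIncreasingWithRuns-++-min k a' α' b' β' (arrangements-All f x<A m) (arrangements-All f x<B m')) ⟩
        count (λ β → nullᵇ (valleyHeights (a' ∷ α')) ∧ isIncreasingWithRuns (k ∸ suc (descents (a' ∷ α'))) β) (arrangements f (b ∷ B))
      ≡⟨ count-∧ (nullᵇ (valleyHeights (a' ∷ α'))) _ (arrangements f (b ∷ B)) ⟩
        𝟙 (nullᵇ (valleyHeights (a' ∷ α'))) * count (isIncreasingWithRuns (k ∸ suc (descents (a' ∷ α')))) (arrangements f (b ∷ B))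
      ≡⟨ cong (𝟙 (nullᵇ (valleyHeights (a' ∷ α'))) *_) (count-increasing-sorted f _ (b ∷ B) sB lB) ⟩
        𝟙 (nullᵇ (valleyHeights (a' ∷ α'))) * incRun (suc (length B)) (k ∸ suc (descents (a' ∷ α'))) ∎
    descents-≤ : ∀ {α} → α ∈ arrangements f (a ∷ A) → descents α ≤ length A
    descents-≤ m with ∈-arrangements-∷ f m
    ... | a' , α' , refl = ≤-trans (descents-∷-≤ a' α') (≤-reflexive (suc-injective (↭-length (arrangements-↭ f (a ∷ A) m))))

incRun-no-runs : ∀ n → n ≥ 1 → incRun n 0 ≡ 0
incRun-no-runs (suc n) _ = trans (incRun≡count (suc n) 0) (count-none _ (perms (suc n)) noRuns)
  where
  noRuns : ∀ {π} → π ∈ perms (suc n) → isIncreasingWithRuns 0 π ≡ false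
  noRuns m with ↭-∷⇒∷ (∈-perms⇒↭ (suc n) m)
  ... | _ , _ , refl = ∧-zeroʳ _

incRun-suc-bySplits : ∀ n k' → incRun (suc n) (suc k') ≡ sumBelow (suc n) (λ i → (n C i) * increasingSplitCount k' i (n ∸ i))
incRun-suc-bySplits n k' = begin
    incRun (suc n) (suc k')
  ≡⟨ incRun≡count (suc n) (suc k') ⟩
    count (isIncreasingWithRuns (suc k')) (perms (suc n))
  ≡⟨ count-perms≡count-arrangements _ (suc n) (suc n) ≤-refl ⟩
    count (isIncreasingWithRuns (suc k')) (arrangements (suc n) (1 ∷ range 2 n))
  ≡⟨ count-increasing k' n 1 (range 2 n) (range-sorted 2 n) (range-≥ 2 n) (≤-reflexive (length-range 2 n)) ⟩
    sumBelow (suc (length (range 2 n))) (λ i → (length (range 2 n) C i) * increasingSplitCount k' i (length (range 2 n) ∸ i))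
  ≡⟨ cong (λ r → sumBelow (suc r) (λ i → (r C i) * increasingSplitCount k' i (r ∸ i))) (length-range 2 n) ⟩
    sumBelow (suc n) (λ i → (n C i) * increasingSplitCount k' i (n ∸ i)) ∎
  where open ≡-Reasoning

-- Substitute j = k − 1 − d for the number d of descents of the left part.
sumBelow-byRuns : ∀ k' t (I : ℕ → ℕ) → I 0 ≡ 0 →
  sumBelow (suc t) (λ d → (t C d) * I (k' ∸ d)) ≡ sumBelow k' (λ s → (t C (k' ∸ s ∸ 1)) * I (suc s))
sumBelow-byRuns k' t I I0≡0 = trans truncate (sym reverse)
  where
  F : ℕ → ℕ
  F d = (t C d) * I (k' ∸ d)
  reverse : sumBelow k' (λ s → (t C (k' ∸ s ∸ 1)) * I (suc s)) ≡ sumBelow k' F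
  reverse = trans (sumBelow-reverse k' _) (sumBelow-cong k' (λ d d<k' →
    cong₂ _*_ (cong (λ z → t C (z ∸ 1)) (m∸[m∸n]≡n d<k')) (cong I (sym (+-∸-assoc 1 d<k')))))
  truncate : sumBelow (suc t) F ≡ sumBelow k' F
  truncate with ≤-total k' (suc t)
  ... | inj₁ k'≤ = sumBelow-extend k' (suc t) F k'≤ (λ i k'≤i _ →
    trans (cong (λ z → (t C i) * I z) (m≤n⇒m∸n≡0 k'≤i)) (trans (cong ((t C i) *_) I0≡0) (*-zeroʳ (t C i))))
  ... | inj₂ ≤k' = sym (sumBelow-extend (suc t) k' F ≤k' (λ i t<i _ → cong (_* I (k' ∸ i)) (k>n⇒nCk≡0 t<i)))

increasingSplitCount≡sumFromTo : ∀ k' c t m → m ≥ 1 →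
  c * increasingSplitCount k' (suc t) m ≡ sumFromTo 1 k' (λ j → c * (t C (suc k' ∸ j ∸ 1)) * incRun m j)
increasingSplitCount≡sumFromTo k' c t (suc m') _ = begin
    c * sumBelow (suc t) (λ d → (t C d) * I (k' ∸ d))
  ≡⟨ cong (c *_) (sumBelow-byRuns k' t I (incRun-no-runs (suc m') (s≤s z≤n))) ⟩
    c * sumBelow k' (λ s → (t C (k' ∸ s ∸ 1)) * I (suc s))
  ≡⟨ *-distribˡ-sumBelow k' c _ ⟩
    sumBelow k' (λ s → c * ((t C (k' ∸ s ∸ 1)) * I (suc s)))
  ≡⟨ sumBelow-cong k' (λ s _ → sym (*-assoc c _ _)) ⟩
    sumBelow k' (λ s → c * (t C (k' ∸ s ∸ 1)) * I (suc s))
  ≡⟨ sym (sumFromTo1≡sumBelow k' (λ j → c * (t C (suc k' ∸ j ∸ 1)) * I j)) ⟩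
    sumFromTo 1 k' (λ j → c * (t C (suc k' ∸ j ∸ 1)) * I j) ∎
  where
  open ≡-Reasoning
  I : ℕ → ℕ
  I = incRun (suc m')

incRun-recurrence : (n k : ℕ) → n ≥ 1 → k ≥ 1 →
  incRun (suc n) k ≡ incRun n k + incRun n (k ∸ 1)
    + sumFromTo 1 (n ∸ 1) (λ i → sumFromTo 1 (k ∸ 1) (λ j → (n C i) * ((i ∸ 1) C (k ∸ j ∸ 1)) * incRun (n ∸ i) j))
incRun-recurrence n@(suc n') k@(suc k') _ _ = begin
    incRun (suc n) k
  ≡⟨ incRun-suc-bySplits n k' ⟩
    G 0 + sumBelow n (G ∘ suc)
  ≡⟨ cong₂ _+_ (*-identityˡ (incRun n k)) (sumBelow-suc n' (G ∘ suc)) ⟩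
    incRun n k + (sumBelow n' (G ∘ suc) + G n)
  ≡⟨ cong (λ z → incRun n k + (sumBelow n' (G ∘ suc) + z)) (trans (cong₂ _*_ (nCn≡1 n) (cong (increasingSplitCount k' n) (n∸n≡0 n))) (*-identityˡ _)) ⟩
    incRun n k + (sumBelow n' (G ∘ suc) + incRun n k')
  ≡⟨ trans (cong (incRun n k +_) (+-comm _ (incRun n k'))) (sym (+-assoc (incRun n k) (incRun n k') _)) ⟩
    incRun n k + incRun n k' + sumBelow n' (G ∘ suc)
  ≡⟨ cong (incRun n k + incRun n k' +_) (sumBelow-cong n' (λ t t<n' →
       increasingSplitCount≡sumFromTo k' (n C suc t) t (n' ∸ t) (m<n⇒0<n∸m t<n'))) ⟩
    incRun n k + incRun n k' + sumBelow n' (Inner ∘ suc)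
  ≡⟨ cong (incRun n k + incRun n k' +_) (sym (sumFromTo1≡sumBelow n' Inner)) ⟩
    incRun n k + incRun n k' + sumFromTo 1 n' Inner ∎
  where
  open ≡-Reasoning
  G : ℕ → ℕ
  G i = (n C i) * increasingSplitCount k' i (n ∸ i)
  Inner : ℕ → ℕ
  Inner i = sumFromTo 1 k' (λ j → (n C i) * ((i ∸ 1) C (k ∸ j ∸ 1)) * incRun (n ∸ i) j)

corollary2p6 : (incRun 0 0 ≡ 1)
    × ((n : ℕ) → n ≥ 1 → incRun n 0 ≡ 0)
    × ((n k : ℕ) → n ≥ 1 → k ≥ 1 →
    incRun (suc n) k
    ≡ incRun n k + incRun n (k ∸ 1)
    + sumFromTo 1 (n ∸ 1) (λ i → sumFromTo 1 (k ∸ 1) (λ j →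
    (n C i) * ((i ∸ 1) C (k ∸ j ∸ 1)) * incRun (n ∸ i) j)))
corollary2p6 = refl , incRun-no-runs , incRun-recurrence
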